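{- Let $m \ge 1$ and let $C$ be a binary LCD $[2m+3,3]$ code with $d(C^\perp)\ge 2$. Then there is a $3$-cover $(Y_1,Y_2,Y_3)$ of the $m$-set $X=\{1,\dots,m\}$ such that $C$ is equivalent to $C((Y_1,Y_2,Y_3))$.
   Context: A $3$-cover of $X$ is a sequence $(Y_1,Y_2,Y_3)$ of (not necessarily distinct) subsets of $X$ with $Y_1\cup Y_2\cup Y_3=X$. For a positive integer $a$ write $a+Y=\{a+y\mid y\in Y\}$. Set $Z_i=\{i\}\cup(3+Y_i)\cup(3+m+Y_i)\subseteq\{1,\dots,2m+3\}$ for $i=1,2,3$, let $z_i\in\mathbb{F}_2^{2m+3}$ be the characteristic vector of $Z_i$, and let $C((Y_1,Y_2,Y_3))$ be the binary code generated by $z_1,z_2,z_3$. A binary $[n,k]$ code is a $k$-dimensional subspace of $\mathbb{F}_2^n$; $C$ is LCD if $C\cap C^\perp=\{\mathbf{0}_n\}$; $d(D)$ is the minimum nonzero Hamming weight of $D$. Two binary codes are equivalent if one is obtained from the other by a permutation of coordinates. -}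

module Defs where

open import Data.Nat using (ℕ; zero; suc; _+_)
open import Data.Bool using (Bool; true; false; _∧_; _∨_; _xor_; if_then_else_)
open import Data.Fin using (Fin; zero; suc; splitAt; _≟_)
open import Data.Fin.Permutation using (Permutation′; _⟨$⟩ʳ_)
open import Data.Sum using (_⊎_; inj₁; inj₂)
open import Data.Product using (Σ; ∃; _×_; _,_)
open import Function using (_∘_)
open import Function.Bundles using (_⇔_)
open import Relation.Binary.PropositionalEquality using (_≡_)
open import Relation.Nullary.Decidable using (⌊_⌋)

Word : ℕ → Set
Word n = Fin n → Bool

Code : ℕ → Set₁
Code n = Word n → Set

xorSum : ∀ {k} → (Fin k → Bool) → Bool
xorSum {zero} f = false
xorSum {suc k} f = f zero xor xorSum (f ∘ suc)

weight : ∀ {n} → Word n → ℕ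
weight {zero} w = 0
weight {suc n} w = (if w zero then 1 else 0) + weight (w ∘ suc)

IsZero : ∀ {n} → Word n → Set
IsZero w = ∀ j → w j ≡ false

dot : ∀ {n} → Word n → Word n → Bool
dot w v = xorSum (λ j → w j ∧ v j)

lincomb : ∀ {k n} → (Fin k → Bool) → (Fin k → Word n) → Word n
lincomb c g j = xorSum (λ i → c i ∧ g i j)

InSpan : ∀ {k n} → (Fin k → Word n) → Code n
InSpan g w = ∃ λ c → ∀ j → w j ≡ lincomb c g j

LinIndep : ∀ {k n} → (Fin k → Word n) → Set
LinIndep g = ∀ c → IsZero (lincomb c g) → ∀ i → c i ≡ false

IsLinearCode : ∀ n k → Code n → Set
IsLinearCode n k C = Σ (Fin k → Word n) λ g → LinIndep g × (∀ w → C w ⇔ InSpan g w)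

Dual : ∀ {n} → Code n → Code n
Dual C w = ∀ v → C v → dot w v ≡ false

IsLCD : ∀ {n} → Code n → Set
IsLCD C = ∀ w → C w → Dual C w → IsZero w

MinDistAtLeast : ∀ {n} → Code n → ℕ → Set
MinDistAtLeast C d = ∀ w → C w → (IsZero w → Data.Empty.⊥) → d Data.Nat.≤ weight w
  where import Data.Empty; import Data.Nat

Equivalent : ∀ {n} → Code n → Code n → Set
Equivalent {n} C D = Σ (Permutation′ n) λ σ → ∀ w → C w ⇔ D (w ∘ (σ ⟨$⟩ʳ_))

-- subsets of X = {1,…,m}, indexed 0-based by Fin m
Subset : ℕ → Set
Subset m = Fin m → Bool

Is3Cover : ∀ {m} → (Fin 3 → Subset m) → Set
Is3Cover Y = ∀ x → (Y zero x ∨ Y (suc zero) x ∨ Y (suc (suc zero)) x) ≡ true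

-- characteristic vector z_i of Z_i = {i} ∪ (3+Y_i) ∪ (3+m+Y_i) ⊆ {1,…,2m+3},
-- length written as 3 + (m + m), coordinates 0-based
zvec : ∀ {m} → (Fin 3 → Subset m) → Fin 3 → Word (3 + (m + m))
zvec {m} Y i j with splitAt 3 j
... | inj₁ k = ⌊ k ≟ i ⌋
... | inj₂ r with splitAt m r
...   | inj₁ y = Y i y
...   | inj₂ y = Y i y

CY : ∀ {m} → (Fin 3 → Subset m) → Code (3 + (m + m))
CY Y = InSpan (zvec Y)

-- Write g for a generator matrix of C; its columns are vectors of F₂³, none of them zero since
-- d(C⊥) ≥ 2, and since C is LCD the Gram matrix g gᵀ = Σⱼ cⱼ cⱼᵀ is invertible. Arrange the columns as
-- a block of s pairwise distinct columns followed by p pairs of equal columns. The pairs cancel in the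
-- Gram matrix, so the distinct columns alone have an invertible Gram matrix; a finite check over the
-- subsets of F₂³ ∖ {0} shows that this forces s ∈ {3, 4}, and since 2m + 3 = s + 2p is odd, s = 3 and
-- p = m. The three distinct columns then form a basis of F₂³, and multiplying g by the inverse of the
-- matrix of this basis turns them into the unit vectors, while the i-th rows of the two copies of the
-- pairs become the indicator vector of a set Yᵢ. Nonzero columns stay nonzero, so the Yᵢ cover X.

module Submission where

open import Defs
open import Algebra.Bundles using (CommutativeRing)
open import Data.Bool using (Bool; true; false; _∧_; _∨_; _xor_)
open import Data.Bool.Properties
  using (xor-∧-commutativeRing; ∧-comm; ∧-assoc; ∧-zeroʳ; xor-same; xor-assoc; xor-identityʳ)
import Data.Bool.Properties as Bool using (_≟_)
open import Data.Empty using (⊥; ⊥-elim)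
open import Data.Fin using (Fin; zero; suc; toℕ; fromℕ<; punchIn; punchOut; _≟_; _↑ˡ_; _↑ʳ_; splitAt)
open import Data.Fin.Properties
  using (toℕ-injective; toℕ-fromℕ<; all?; any?; punchIn-punchOut; toℕ-↑ˡ; toℕ-↑ʳ; toℕ<n; splitAt⁻¹-↑ˡ; splitAt⁻¹-↑ʳ)
import Data.Fin.Properties as Fin using (suc-injective)
open import Data.Fin.Permutation as Perm using (Permutation; Permutation′; _⟨$⟩ʳ_; _⟨$⟩ˡ_; _∘ₚ_; inverseʳ)
import Data.Fin.Permutation.Components as PC
open import Data.Nat using (ℕ; zero; suc; _+_; _≤_; _<_; s≤s; _<?_; ⌊_/2⌋)
import Data.Nat as ℕ using (_≟_)
open import Data.Nat.Properties
  using (<-irrefl; <-asym; ≮⇒≥; m≤m+n; +-suc; +-monoʳ-≤; +-monoʳ-<; <-trans; n<1+n; <-≤-trans;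
         ≤-trans; m≤n⇒m<n∨m≡n; +-mono-≤-<; suc-injective; +-comm; +-assoc; n≡⌊n+n/2⌋; 1+n≰n)
open import Data.Product using (Σ; _×_; _,_; proj₁; proj₂)
open import Data.Product.Properties using (≡-dec)
open import Data.Sum using (_⊎_; inj₁; inj₂)
open import Function using (_∘_; case_of_)
open import Function.Bundles using (_⇔_; mk⇔; Equivalence)
open import Relation.Binary.Definitions using (DecidableEquality)
open import Relation.Binary.PropositionalEquality
open import Relation.Nullary using (Dec; yes; no; does; ¬_)
open import Relation.Nullary.Decidable
  using (⌊_⌋; from-yes; map′; dec-true; _×-dec_; _→-dec_; _⊎-dec_)

open import Algebra.Properties.Semiring.Sum (CommutativeRing.semiring xor-∧-commutativeRing)
  using (sum; sum-cong-≗; sum-replicate-zero; ∑-comm; ∑-permute; *-distribˡ-sum)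

open ≡-Reasoning

xorSum≡sum : ∀ {k} (f : Fin k → Bool) → xorSum f ≡ sum f
xorSum≡sum {zero} f = refl
xorSum≡sum {suc k} f = cong (f zero xor_) (xorSum≡sum (f ∘ suc))

xorSum-cong : ∀ {k} {f g : Fin k → Bool} → f ≗ g → xorSum f ≡ xorSum g
xorSum-cong {f = f} {g} f≗g = begin
  xorSum f ≡⟨ xorSum≡sum f ⟩
  sum f    ≡⟨ sum-cong-≗ f≗g ⟩
  sum g    ≡⟨ xorSum≡sum g ⟨
  xorSum g ∎

xorSum-false : ∀ k → xorSum {k} (λ _ → false) ≡ false
xorSum-false k = trans (xorSum≡sum {k} (λ _ → false)) (sum-replicate-zero k)

xorSum-comm : ∀ {a b} (f : Fin a → Fin b → Bool) →
  xorSum (λ i → xorSum (f i)) ≡ xorSum (λ j → xorSum (λ i → f i j))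
xorSum-comm f = begin
  xorSum (λ i → xorSum (f i))                ≡⟨ xorSum≡sum (λ i → xorSum (f i)) ⟩
  sum (λ i → xorSum (f i))                   ≡⟨ sum-cong-≗ (xorSum≡sum ∘ f) ⟩
  sum (λ i → sum (f i))                      ≡⟨ ∑-comm f ⟩
  sum (λ j → sum (λ i → f i j))              ≡⟨ sum-cong-≗ (λ j → xorSum≡sum (λ i → f i j)) ⟨
  sum (λ j → xorSum (λ i → f i j))           ≡⟨ xorSum≡sum (λ j → xorSum (λ i → f i j)) ⟨
  xorSum (λ j → xorSum (λ i → f i j))        ∎

∧-distribˡ-xorSum : ∀ {k} a (f : Fin k → Bool) → a ∧ xorSum f ≡ xorSum (λ i → a ∧ f i)
∧-distribˡ-xorSum a f = begin
  a ∧ xorSum f               ≡⟨ cong (a ∧_) (xorSum≡sum f) ⟩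
  a ∧ sum f                  ≡⟨ *-distribˡ-sum a f ⟩
  sum (λ i → a ∧ f i)        ≡⟨ xorSum≡sum (λ i → a ∧ f i) ⟨
  xorSum (λ i → a ∧ f i)     ∎

∧-distribʳ-xorSum : ∀ {k} a (f : Fin k → Bool) → xorSum f ∧ a ≡ xorSum (λ i → f i ∧ a)
∧-distribʳ-xorSum a f = begin
  xorSum f ∧ a             ≡⟨ ∧-comm (xorSum f) a ⟩
  a ∧ xorSum f             ≡⟨ ∧-distribˡ-xorSum a f ⟩
  xorSum (λ i → a ∧ f i)   ≡⟨ xorSum-cong (λ i → ∧-comm a (f i)) ⟩
  xorSum (λ i → f i ∧ a)   ∎

xorSum-permute : ∀ {m n} (f : Fin n → Bool) (π : Permutation m n) →
  xorSum f ≡ xorSum (λ i → f (π ⟨$⟩ʳ i))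
xorSum-permute f π = begin
  xorSum f                     ≡⟨ xorSum≡sum f ⟩
  sum f                        ≡⟨ ∑-permute f π ⟩
  sum (λ i → f (π ⟨$⟩ʳ i))     ≡⟨ xorSum≡sum (λ i → f (π ⟨$⟩ʳ i)) ⟨
  xorSum (λ i → f (π ⟨$⟩ʳ i))  ∎

xorSum-++ : ∀ a {b} (f : Fin (a + b) → Bool) →
  xorSum f ≡ xorSum (λ i → f (i ↑ˡ b)) xor xorSum (λ i → f (a ↑ʳ i))
xorSum-++ zero f = refl
xorSum-++ (suc a) f = trans (cong (f zero xor_) (xorSum-++ a (f ∘ suc))) (sym (xor-assoc (f zero) _ _))

xorSum-paired : ∀ p (f : Fin (p + p) → Bool) → (∀ x → f (x ↑ˡ p) ≡ f (p ↑ʳ x)) → xorSum f ≡ false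
xorSum-paired p f paired = begin
  xorSum f                                  ≡⟨ xorSum-++ p f ⟩
  xorSum (f ∘ (_↑ˡ p)) xor xorSum (f ∘ (p ↑ʳ_)) ≡⟨ cong (_xor xorSum (f ∘ (p ↑ʳ_))) (xorSum-cong paired) ⟩
  xorSum (f ∘ (p ↑ʳ_)) xor xorSum (f ∘ (p ↑ʳ_)) ≡⟨ xor-same (xorSum (f ∘ (p ↑ʳ_))) ⟩
  false                                     ∎

dot-comm : ∀ {n} (w v : Word n) → dot w v ≡ dot v w
dot-comm w v = xorSum-cong (λ j → ∧-comm (w j) (v j))

dot-lincombˡ : ∀ {k n} (c : Fin k → Bool) (g : Fin k → Word n) (v : Word n) →
  dot (lincomb c g) v ≡ xorSum (λ i → c i ∧ dot (g i) v)
dot-lincombˡ c g v = begin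
  xorSum (λ j → xorSum (λ i → c i ∧ g i j) ∧ v j)
    ≡⟨ xorSum-cong (λ j → trans (∧-distribʳ-xorSum (v j) (λ i → c i ∧ g i j))
                                (xorSum-cong (λ i → ∧-assoc (c i) (g i j) (v j)))) ⟩
  xorSum (λ j → xorSum (λ i → c i ∧ (g i j ∧ v j)))
    ≡⟨ xorSum-comm (λ j i → c i ∧ (g i j ∧ v j)) ⟩
  xorSum (λ i → xorSum (λ j → c i ∧ (g i j ∧ v j)))
    ≡⟨ xorSum-cong (λ i → ∧-distribˡ-xorSum (c i) (λ j → g i j ∧ v j)) ⟨
  xorSum (λ i → c i ∧ dot (g i) v) ∎

dot-lincombʳ : ∀ {k n} (w : Word n) (c : Fin k → Bool) (g : Fin k → Word n) →
  dot w (lincomb c g) ≡ xorSum (λ i → c i ∧ dot w (g i))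
dot-lincombʳ w c g = begin
  dot w (lincomb c g)              ≡⟨ dot-comm w _ ⟩
  dot (lincomb c g) w              ≡⟨ dot-lincombˡ c g w ⟩
  xorSum (λ i → c i ∧ dot (g i) w) ≡⟨ xorSum-cong (λ i → cong (c i ∧_) (dot-comm (g i) w)) ⟩
  xorSum (λ i → c i ∧ dot w (g i)) ∎

lincomb-lincomb : ∀ {k l n} (c : Fin k → Bool) (B : Fin k → Fin l → Bool) (z : Fin l → Word n) →
  lincomb c (λ i → lincomb (B i) z) ≗ lincomb (λ r → xorSum (λ i → c i ∧ B i r)) z
lincomb-lincomb c B z j = begin
  xorSum (λ i → c i ∧ xorSum (λ r → B i r ∧ z r j))
    ≡⟨ xorSum-cong (λ i → trans (∧-distribˡ-xorSum (c i) (λ r → B i r ∧ z r j))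
                                (xorSum-cong (λ r → sym (∧-assoc (c i) (B i r) (z r j))))) ⟩
  xorSum (λ i → xorSum (λ r → (c i ∧ B i r) ∧ z r j))
    ≡⟨ xorSum-comm (λ i r → (c i ∧ B i r) ∧ z r j) ⟩
  xorSum (λ r → xorSum (λ i → (c i ∧ B i r) ∧ z r j))
    ≡⟨ xorSum-cong (λ r → ∧-distribʳ-xorSum (z r j) (λ i → c i ∧ B i r)) ⟨
  xorSum (λ r → xorSum (λ i → c i ∧ B i r) ∧ z r j) ∎

InSpan-trans : ∀ {k l n} {g : Fin k → Word n} {z : Fin l → Word n} →
  (∀ i → InSpan z (g i)) → ∀ w → InSpan g w → InSpan z w
InSpan-trans {g = g} {z} g⊆z w (c , w≡cg) =
  (λ r → xorSum (λ i → c i ∧ B i r)) , λ j → begin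
    w j                                 ≡⟨ w≡cg j ⟩
    lincomb c g j                       ≡⟨ xorSum-cong (λ i → cong (c i ∧_) (proj₂ (g⊆z i) j)) ⟩
    lincomb c (λ i → lincomb (B i) z) j ≡⟨ lincomb-lincomb c B z j ⟩
    lincomb (λ r → xorSum (λ i → c i ∧ B i r)) z j ∎
  where
  B = λ i → proj₁ (g⊆z i)

InSpan-permute : ∀ {k n} (g : Fin k → Word n) (σ : Permutation′ n) w →
  InSpan g w → InSpan (λ i → g i ∘ (σ ⟨$⟩ʳ_)) (w ∘ (σ ⟨$⟩ʳ_))
InSpan-permute g σ w (c , w≡cg) = c , w≡cg ∘ (σ ⟨$⟩ʳ_)

InSpan-unpermute : ∀ {k n} (g : Fin k → Word n) (σ : Permutation′ n) w →
  InSpan (λ i → g i ∘ (σ ⟨$⟩ʳ_)) (w ∘ (σ ⟨$⟩ʳ_)) → InSpan g w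
InSpan-unpermute g σ w (c , wσ≡cgσ) = c , λ j → begin
  w j                              ≡⟨ cong w (inverseʳ σ) ⟨
  w (σ ⟨$⟩ʳ (σ ⟨$⟩ˡ j))            ≡⟨ wσ≡cgσ (σ ⟨$⟩ˡ j) ⟩
  lincomb c g (σ ⟨$⟩ʳ (σ ⟨$⟩ˡ j))  ≡⟨ cong (lincomb c g) (inverseʳ σ) ⟩
  lincomb c g j                    ∎

-- Linear algebra in F₂³

B³ : Set
B³ = Bool × Bool × Bool

_!_ : B³ → Fin 3 → Bool
(a , _ , _) ! zero = a
(_ , b , _) ! suc zero = b
(_ , _ , c) ! suc (suc zero) = c

0³ : B³
0³ = false , false , false

unit³ : Fin 3 → B³
unit³ k = ⌊ k ≟ zero ⌋ , ⌊ k ≟ suc zero ⌋ , ⌊ k ≟ suc (suc zero) ⌋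

nonzero : B³ → Bool
nonzero (a , b , c) = a ∨ b ∨ c

_≟³_ : DecidableEquality B³
_≟³_ = ≡-dec Bool._≟_ (≡-dec Bool._≟_ Bool._≟_)

_⊕³_ : B³ → B³ → B³
(a , b , c) ⊕³ (d , e , f) = a xor d , b xor e , c xor f

_*³_ : Bool → B³ → B³
x *³ (a , b , c) = x ∧ a , x ∧ b , x ∧ c

_⊙_ : B³ → B³ → Bool
u ⊙ v = xorSum (λ k → u ! k ∧ v ! k)

-- 3 × 3 matrices, given by their rows
Mat³ : Set
Mat³ = B³ × B³ × B³

_≟ᴹ_ : DecidableEquality Mat³
_≟ᴹ_ = ≡-dec _≟³_ (≡-dec _≟³_ _≟³_)

row : Mat³ → Fin 3 → B³
row (r , _ , _) zero = r
row (_ , r , _) (suc zero) = r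
row (_ , _ , r) (suc (suc zero)) = r

entry : Mat³ → Fin 3 → Fin 3 → Bool
entry M i k = row M i ! k

O : Mat³
O = 0³ , 0³ , 0³

_⊕_ : Mat³ → Mat³ → Mat³
(a , b , c) ⊕ (d , e , f) = a ⊕³ d , b ⊕³ e , c ⊕³ f

_·_ : Mat³ → B³ → B³
(r₀ , r₁ , r₂) · v = r₀ ⊙ v , r₁ ⊙ v , r₂ ⊙ v

outer : B³ → Mat³
outer v = (v ! zero) *³ v , (v ! suc zero) *³ v , (v ! suc (suc zero)) *³ v

columns : (Fin 3 → B³) → Mat³
columns h = rowOf zero , rowOf (suc zero) , rowOf (suc (suc zero))
  where
  rowOf : Fin 3 → B³
  rowOf i = h zero ! i , h (suc zero) ! i , h (suc (suc zero)) ! i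

det : Mat³ → Bool
det ((a , b , c) , (d , e , f) , (g , h , i)) =
  (a ∧ ((e ∧ i) xor (f ∧ h))) xor ((b ∧ ((d ∧ i) xor (f ∧ g))) xor (c ∧ ((d ∧ h) xor (e ∧ g))))

adj : Mat³ → Mat³
adj ((a , b , c) , (d , e , f) , (g , h , i)) =
  ((e ∧ i) xor (f ∧ h) , (b ∧ i) xor (c ∧ h) , (b ∧ f) xor (c ∧ e)) ,
  ((d ∧ i) xor (f ∧ g) , (a ∧ i) xor (c ∧ g) , (a ∧ f) xor (c ∧ d)) ,
  ((d ∧ h) xor (e ∧ g) , (a ∧ h) xor (b ∧ g) , (a ∧ e) xor (b ∧ d))

gram : ∀ {n} → (Fin n → B³) → Mat³
gram {zero} _ = O
gram {suc n} h = outer (h zero) ⊕ gram (h ∘ suc)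

!-⊕³ : ∀ u v k → (u ⊕³ v) ! k ≡ u ! k xor v ! k
!-⊕³ u v zero = refl
!-⊕³ u v (suc zero) = refl
!-⊕³ u v (suc (suc zero)) = refl

!-*³ : ∀ x v k → (x *³ v) ! k ≡ x ∧ v ! k
!-*³ x v zero = refl
!-*³ x v (suc zero) = refl
!-*³ x v (suc (suc zero)) = refl

!-0³ : ∀ k → 0³ ! k ≡ false
!-0³ zero = refl
!-0³ (suc zero) = refl
!-0³ (suc (suc zero)) = refl

!-unit³ : ∀ k i → unit³ k ! i ≡ ⌊ k ≟ i ⌋
!-unit³ k zero = refl
!-unit³ k (suc zero) = refl
!-unit³ k (suc (suc zero)) = refl

!-· : ∀ M v i → (M · v) ! i ≡ xorSum (λ k → entry M i k ∧ v ! k)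
!-· M v zero = refl
!-· M v (suc zero) = refl
!-· M v (suc (suc zero)) = refl

nonzero-! : ∀ v → nonzero v ≡ true → Σ (Fin 3) λ k → v ! k ≡ true
nonzero-! (true , _ , _) _ = zero , refl
nonzero-! (false , true , _) _ = suc zero , refl
nonzero-! (false , false , true) _ = suc (suc zero) , refl

row-⊕ : ∀ M N i → row (M ⊕ N) i ≡ row M i ⊕³ row N i
row-⊕ M N zero = refl
row-⊕ M N (suc zero) = refl
row-⊕ M N (suc (suc zero)) = refl

row-outer : ∀ v i → row (outer v) i ≡ (v ! i) *³ v
row-outer v zero = refl
row-outer v (suc zero) = refl
row-outer v (suc (suc zero)) = refl

row-O : ∀ i → row O i ≡ 0³
row-O zero = refl
row-O (suc zero) = refl
row-O (suc (suc zero)) = refl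

entry-columns : ∀ h i k → entry (columns h) i k ≡ h k ! i
entry-columns h zero zero = refl
entry-columns h zero (suc zero) = refl
entry-columns h zero (suc (suc zero)) = refl
entry-columns h (suc zero) zero = refl
entry-columns h (suc zero) (suc zero) = refl
entry-columns h (suc zero) (suc (suc zero)) = refl
entry-columns h (suc (suc zero)) zero = refl
entry-columns h (suc (suc zero)) (suc zero) = refl
entry-columns h (suc (suc zero)) (suc (suc zero)) = refl

B³-ext : ∀ {u v} → (∀ k → u ! k ≡ v ! k) → u ≡ v
B³-ext u≗v = cong₂ _,_ (u≗v zero) (cong₂ _,_ (u≗v (suc zero)) (u≗v (suc (suc zero))))

Mat³-ext : ∀ {M N} → (∀ i k → entry M i k ≡ entry N i k) → M ≡ N
Mat³-ext M≗N = cong₂ _,_ (B³-ext (M≗N zero)) (cong₂ _,_ (B³-ext (M≗N (suc zero))) (B³-ext (M≗N (suc (suc zero)))))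

entry-gram : ∀ {n} (h : Fin n → B³) i k → entry (gram h) i k ≡ xorSum (λ j → h j ! i ∧ h j ! k)
entry-gram {zero} h i k = trans (cong (_! k) (row-O i)) (!-0³ k)
entry-gram {suc n} h i k = begin
  row (outer (h zero) ⊕ gram (h ∘ suc)) i ! k
    ≡⟨ cong (_! k) (row-⊕ (outer (h zero)) (gram (h ∘ suc)) i) ⟩
  (row (outer (h zero)) i ⊕³ row (gram (h ∘ suc)) i) ! k
    ≡⟨ !-⊕³ (row (outer (h zero)) i) _ k ⟩
  row (outer (h zero)) i ! k xor entry (gram (h ∘ suc)) i k
    ≡⟨ cong₂ _xor_ (trans (cong (_! k) (row-outer (h zero) i)) (!-*³ (h zero ! i) (h zero) k)) (entry-gram (h ∘ suc) i k) ⟩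
  (h zero ! i ∧ h zero ! k) xor xorSum (λ j → h (suc j) ! i ∧ h (suc j) ! k) ∎

-- Facts about F₂³ checked by exhaustive search

∀-Bool? : {P : Bool → Set} → (∀ b → Dec (P b)) → Dec (∀ b → P b)
∀-Bool? P? with P? true | P? false
... | yes t | yes f = yes λ { true → t ; false → f }
... | no ¬t | _ = no λ h → ¬t (h true)
... | yes _ | no ¬f = no λ h → ¬f (h false)

∃-Bool? : {P : Bool → Set} → (∀ b → Dec (P b)) → Dec (Σ Bool P)
∃-Bool? P? with P? true | P? false
... | yes t | _ = yes (true , t)
... | no _ | yes f = yes (false , f)
... | no ¬t | no ¬f = no λ { (true , t) → ¬t t ; (false , f) → ¬f f }

∀-B³? : {P : B³ → Set} → (∀ v → Dec (P v)) → Dec (∀ v → P v)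
∀-B³? P? = map′ (λ h v → h (proj₁ v) (proj₁ (proj₂ v)) (proj₂ (proj₂ v))) (λ h a b c → h (a , b , c))
  (∀-Bool? λ a → ∀-Bool? λ b → ∀-Bool? λ c → P? (a , b , c))

∃-B³? : {P : B³ → Set} → (∀ v → Dec (P v)) → Dec (Σ B³ P)
∃-B³? P? = map′ (λ { (a , b , c , p) → (a , b , c) , p }) (λ { ((a , b , c) , p) → a , b , c , p })
  (∃-Bool? λ a → ∃-Bool? λ b → ∃-Bool? λ c → P? (a , b , c))

∀-Mat³? : {P : Mat³ → Set} → (∀ M → Dec (P M)) → Dec (∀ M → P M)
∀-Mat³? P? = map′ (λ h M → h (proj₁ M) (proj₁ (proj₂ M)) (proj₂ (proj₂ M))) (λ h a b c → h (a , b , c))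
  (∀-B³? λ a → ∀-B³? λ b → ∀-B³? λ c → P? (a , b , c))

singular⇒kernel : ∀ M → det M ≡ false → Σ B³ λ c → nonzero c ≡ true × M · c ≡ 0³
singular⇒kernel = from-yes (∀-Mat³? λ M → (det M Bool.≟ false) →-dec
  ∃-B³? λ c → (nonzero c Bool.≟ true) ×-dec ((M · c) ≟³ 0³))

adj-inverseʳ : ∀ M → det M ≡ true → ∀ v → M · (adj M · v) ≡ v
adj-inverseʳ = from-yes (∀-Mat³? λ M → (det M Bool.≟ true) →-dec ∀-B³? λ v → (M · (adj M · v)) ≟³ v)

adj-nonzero : ∀ M → det M ≡ true → ∀ v → nonzero v ≡ true → nonzero (adj M · v) ≡ true
adj-nonzero = from-yes (∀-Mat³? λ M → (det M Bool.≟ true) →-dec ∀-B³? λ v →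
  (nonzero v Bool.≟ true) →-dec (nonzero (adj M · v) Bool.≟ true))

triple : B³ → B³ → B³ → Fin 3 → B³
triple u _ _ zero = u
triple _ v _ (suc zero) = v
triple _ _ w (suc (suc zero)) = w

triple-η : ∀ (h : Fin 3 → B³) k → triple (h zero) (h (suc zero)) (h (suc (suc zero))) k ≡ h k
triple-η h zero = refl
triple-η h (suc zero) = refl
triple-η h (suc (suc zero)) = refl

adj-columns : ∀ h → det (columns h) ≡ true → ∀ k → adj (columns h) · h k ≡ unit³ k
adj-columns h invertible k = subst (λ v → adj (columns h) · v ≡ unit³ k) (triple-η h k)
  (from-yes (∀-Mat³? λ (u , v , w) → (det (columns (triple u v w)) Bool.≟ true) →-dec
    all? λ k → (adj (columns (triple u v w)) · triple u v w k) ≟³ unit³ k)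
    (h zero , h (suc zero) , h (suc (suc zero))) invertible k)

det-gram : ∀ h → det (gram {3} h) ≡ true → det (columns h) ≡ true
det-gram h = from-yes (∀-Mat³? λ (u , v , w) → (det (gram (triple u v w)) Bool.≟ true) →-dec
  (det (columns (triple u v w)) Bool.≟ true)) (h zero , h (suc zero) , h (suc (suc zero)))

Subset³ : Set
Subset³ = B³ → Bool

nonzeroVector : Fin 7 → B³
nonzeroVector zero = true , false , false
nonzeroVector (suc zero) = false , true , false
nonzeroVector (suc (suc zero)) = true , true , false
nonzeroVector (suc (suc (suc zero))) = false , false , true
nonzeroVector (suc (suc (suc (suc zero)))) = true , false , true
nonzeroVector (suc (suc (suc (suc (suc zero))))) = false , true , true
nonzeroVector (suc (suc (suc (suc (suc (suc zero)))))) = true , true , true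

gramOf : Subset³ → Mat³
gramOf S = gram (λ j → S (nonzeroVector j) *³ nonzeroVector j)

size : Subset³ → ℕ
size S = weight (S ∘ nonzeroVector)

toggle : B³ → Subset³ → Subset³
toggle c S v = S v xor does (v ≟³ c)

-- Subset³ is a function type, so statements about all subsets are decided on their tables of values
table : Bool → Bool → Bool → Bool → Bool → Bool → Bool → Bool → Subset³
table b₀ _ _ _ _ _ _ _ (false , false , false) = b₀
table _ b₁ _ _ _ _ _ _ (true , false , false) = b₁
table _ _ b₂ _ _ _ _ _ (false , true , false) = b₂
table _ _ _ b₃ _ _ _ _ (true , true , false) = b₃
table _ _ _ _ b₄ _ _ _ (false , false , true) = b₄
table _ _ _ _ _ b₅ _ _ (true , false , true) = b₅
table _ _ _ _ _ _ b₆ _ (false , true , true) = b₆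
table _ _ _ _ _ _ _ b₇ (true , true , true) = b₇

tabulate : Subset³ → Subset³
tabulate S = table (S (false , false , false)) (S (true , false , false)) (S (false , true , false))
  (S (true , true , false)) (S (false , false , true)) (S (true , false , true)) (S (false , true , true))
  (S (true , true , true))

tabulate-≗ : ∀ S → tabulate S ≗ S
tabulate-≗ S (false , false , false) = refl
tabulate-≗ S (true , false , false) = refl
tabulate-≗ S (false , true , false) = refl
tabulate-≗ S (true , true , false) = refl
tabulate-≗ S (false , false , true) = refl
tabulate-≗ S (true , false , true) = refl
tabulate-≗ S (false , true , true) = refl
tabulate-≗ S (true , true , true) = refl

∀-Subset³? : {P : Subset³ → Set} → (∀ S → Dec (P S)) →
  Dec (∀ b₀ b₁ b₂ b₃ b₄ b₅ b₆ b₇ → P (table b₀ b₁ b₂ b₃ b₄ b₅ b₆ b₇))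
∀-Subset³? P? = ∀-Bool? λ b₀ → ∀-Bool? λ b₁ → ∀-Bool? λ b₂ → ∀-Bool? λ b₃ →
  ∀-Bool? λ b₄ → ∀-Bool? λ b₅ → ∀-Bool? λ b₆ → ∀-Bool? λ b₇ → P? (table b₀ b₁ b₂ b₃ b₄ b₅ b₆ b₇)

atTable : ∀ {P : Subset³ → Set} (S : Subset³) →
  (∀ b₀ b₁ b₂ b₃ b₄ b₅ b₆ b₇ → P (table b₀ b₁ b₂ b₃ b₄ b₅ b₆ b₇)) → P (tabulate S)
atTable S P-table = P-table _ _ _ _ _ _ _ _

gramOf-toggle : ∀ c S → gramOf (toggle c S) ≡ outer c ⊕ gramOf S
gramOf-toggle c S = atTable {λ S → gramOf (toggle c S) ≡ outer c ⊕ gramOf S} S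
  (from-yes (∀-B³? λ c → ∀-Subset³? λ S → gramOf (toggle c S) ≟ᴹ (outer c ⊕ gramOf S)) c)

size-toggle : ∀ c S → nonzero c ≡ true → S c ≡ false → size (toggle c S) ≡ suc (size S)
size-toggle c S c≢0 c∉S =
  atTable {λ S → nonzero c ≡ true → S c ≡ false → size (toggle c S) ≡ suc (size S)} S
    (from-yes (∀-B³? λ c → ∀-Subset³? λ S → (nonzero c Bool.≟ true) →-dec (S c Bool.≟ false) →-dec
      (size (toggle c S) ℕ.≟ suc (size S))) c)
    c≢0 (trans (tabulate-≗ S c) c∉S)

size-invertible-gramOf : ∀ S → det (gramOf S) ≡ true → size S ≡ 3 ⊎ size S ≡ 4
size-invertible-gramOf S = atTable {λ S → det (gramOf S) ≡ true → size S ≡ 3 ⊎ size S ≡ 4} S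
  (from-yes (∀-Subset³? λ S → (det (gramOf S) Bool.≟ true) →-dec ((size S ℕ.≟ 3) ⊎-dec (size S ℕ.≟ 4))))

-- the set of values taken an odd number of times
oddImage : ∀ {s} → (Fin s → B³) → Subset³
oddImage {zero} _ _ = false
oddImage {suc s} h = toggle (h zero) (oddImage (h ∘ suc))

gram-oddImage : ∀ {s} (h : Fin s → B³) → gram h ≡ gramOf (oddImage h)
gram-oddImage {zero} h = refl
gram-oddImage {suc s} h = trans (cong (outer (h zero) ⊕_) (gram-oddImage (h ∘ suc)))
  (sym (gramOf-toggle (h zero) (oddImage (h ∘ suc))))

oddImage⊆image : ∀ {s} (h : Fin s → B³) v → oddImage h v ≡ true → Σ (Fin s) λ a → h a ≡ v
oddImage⊆image {suc s} h v v∈ with v ≟³ h zero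
... | yes v≡h0 = zero , sym v≡h0
... | no _ with oddImage⊆image (h ∘ suc) v (trans (sym (xor-identityʳ _)) v∈)
...   | a , ha≡v = suc a , ha≡v

size-oddImage : ∀ {s} (h : Fin s → B³) → (∀ a b → h a ≡ h b → a ≡ b) → (∀ a → nonzero (h a) ≡ true) →
  size (oddImage h) ≡ s
size-oddImage {zero} h _ _ = refl
size-oddImage {suc s} h injective nonzero-h =
  trans (size-toggle (h zero) (oddImage (h ∘ suc)) (nonzero-h zero) h0∉)
        (cong suc (size-oddImage (h ∘ suc) (λ a b e → Fin.suc-injective (injective (suc a) (suc b) e)) (nonzero-h ∘ suc)))
  where
  h0∉ : oddImage (h ∘ suc) (h zero) ≡ false
  h0∉ with oddImage (h ∘ suc) (h zero) in h0∈
  ... | false = refl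
  ... | true with injective (suc _) zero (proj₂ (oddImage⊆image (h ∘ suc) (h zero) h0∈))
  ...   | ()

size-invertible-gram : ∀ {s} (h : Fin s → B³) → (∀ a b → h a ≡ h b → a ≡ b) → (∀ a → nonzero (h a) ≡ true) →
  det (gram h) ≡ true → s ≡ 3 ⊎ s ≡ 4
size-invertible-gram {s} h injective nonzero-h invertible =
  subst (λ n → n ≡ 3 ⊎ n ≡ 4) (size-oddImage h injective nonzero-h)
    (size-invertible-gramOf (oddImage h) (subst (λ M → det M ≡ true) (gram-oddImage h) invertible))

-- Arranging a sequence into distinct values followed by equal pairs

toℕ-punchIn-< : ∀ {k} (q : Fin (suc k)) (y : Fin k) → toℕ y < toℕ q → toℕ (punchIn q y) ≡ toℕ y
toℕ-punchIn-< zero y ()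
toℕ-punchIn-< (suc q) zero _ = refl
toℕ-punchIn-< (suc q) (suc y) (s≤s y<q) = cong suc (toℕ-punchIn-< q y y<q)

toℕ-punchIn-≥ : ∀ {k} (q : Fin (suc k)) (y : Fin k) → toℕ q ≤ toℕ y → toℕ (punchIn q y) ≡ suc (toℕ y)
toℕ-punchIn-≥ zero y _ = refl
toℕ-punchIn-≥ (suc q) (suc y) (s≤s q≤y) = cong suc (toℕ-punchIn-≥ q y q≤y)

punchIn-below : ∀ {k} (q x : Fin (suc k)) → toℕ x < toℕ q →
  Σ (Fin k) λ y → x ≡ punchIn q y × toℕ y ≡ toℕ x
punchIn-below q x x<q with q ≟ x
... | yes refl = ⊥-elim (<-irrefl refl x<q)
... | no q≢x = y , sym (punchIn-punchOut q≢x) , toℕ-y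
  where
  y = punchOut q≢x
  toℕ-y : toℕ y ≡ toℕ x
  toℕ-y with toℕ y <? toℕ q
  ... | yes y<q = trans (sym (toℕ-punchIn-< q y y<q)) (cong toℕ (punchIn-punchOut q≢x))
  ... | no y≮q = ⊥-elim (<-asym x<q (subst (toℕ q <_)
          (trans (sym (toℕ-punchIn-≥ q y (≮⇒≥ y≮q))) (cong toℕ (punchIn-punchOut q≢x))) (s≤s (≮⇒≥ y≮q))))

punchIn-above : ∀ {k} (q x : Fin (suc k)) → toℕ q < toℕ x →
  Σ (Fin k) λ y → x ≡ punchIn q y × suc (toℕ y) ≡ toℕ x
punchIn-above q x q<x with q ≟ x
... | yes refl = ⊥-elim (<-irrefl refl q<x)
... | no q≢x = y , sym (punchIn-punchOut q≢x) , toℕ-y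
  where
  y = punchOut q≢x
  toℕ-y : suc (toℕ y) ≡ toℕ x
  toℕ-y with toℕ y <? toℕ q
  ... | no y≮q = trans (sym (toℕ-punchIn-≥ q y (≮⇒≥ y≮q))) (cong toℕ (punchIn-punchOut q≢x))
  ... | yes y<q = ⊥-elim (<-asym q<x (subst (_< toℕ q)
          (trans (sym (toℕ-punchIn-< q y y<q)) (cong toℕ (punchIn-punchOut q≢x))) y<q))

insert-at : ∀ {m n} (i : Fin (suc m)) (j : Fin (suc n)) (π : Perm.Permutation m n) → Perm.insert i j π ⟨$⟩ʳ i ≡ j
insert-at i j π with i ≟ i
... | yes _ = refl
... | no i≢i = ⊥-elim (i≢i refl)

transpose-matchʳ : ∀ {n} (i j : Fin n) → PC.transpose i j j ≡ i
transpose-matchʳ i j with j ≟ i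
... | yes refl = refl
... | no _ rewrite dec-true (j ≟ j) refl = refl

transpose-preserves-< : ∀ {n s} (i j x : Fin n) → toℕ i < s → toℕ j < s → toℕ x < s → toℕ (PC.transpose i j x) < s
transpose-preserves-< i j x i<s j<s x<s with x ≟ i
... | yes _ = j<s
... | no _ with x ≟ j
...   | yes _ = i<s
...   | no _ = x<s

transpose-fixes-≥ : ∀ {n s} (i j x : Fin n) → toℕ i < s → toℕ j < s → s ≤ toℕ x → PC.transpose i j x ≡ x
transpose-fixes-≥ i j x i<s j<s s≤x with x ≟ i
... | yes refl = ⊥-elim (<-irrefl refl (<-≤-trans i<s s≤x))
... | no _ with x ≟ j
...   | yes refl = ⊥-elim (<-irrefl refl (<-≤-trans j<s s≤x))
...   | no _ = refl

module _ {ℓ} {X : Set ℓ} where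

  SinglesDistinct : ∀ {k} → (Fin k → X) → Permutation′ k → ℕ → Set ℓ
  SinglesDistinct col π s =
    ∀ a b → toℕ a < s → toℕ b < s → col (π ⟨$⟩ʳ a) ≡ col (π ⟨$⟩ʳ b) → toℕ a ≡ toℕ b

  PairsEqual : ∀ {k} → (Fin k → X) → Permutation′ k → ℕ → ℕ → Set ℓ
  PairsEqual col π s p =
    ∀ a b → s ≤ toℕ a → toℕ a < s + p → toℕ b ≡ toℕ a + p → col (π ⟨$⟩ʳ a) ≡ col (π ⟨$⟩ʳ b)

  record Arrangement {k} (col : Fin k → X) : Set ℓ where
    constructor arrangement
    field
      singles pairs : ℕ
      length : k ≡ singles + (pairs + pairs)
      π : Permutation′ k
      singles-distinct : SinglesDistinct col π singles
      pairs-equal : PairsEqual col π singles pairs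

  Matches : ∀ {k} (col : Fin (suc k) → X) → Arrangement (col ∘ suc) → Set ℓ
  Matches col R = Σ (Fin _) λ a → toℕ a < singles × col (suc (π ⟨$⟩ʳ a)) ≡ col zero
    where open Arrangement R

  extend-unmatched : ∀ {k} (col : Fin (suc k) → X) (R : Arrangement (col ∘ suc)) →
    ¬ Matches col R → Arrangement col
  extend-unmatched col (arrangement s p len π distinct paired) unmatched =
    arrangement (suc s) p (cong suc len) (Perm.lift₀ π) distinct′ paired′
    where
    distinct′ : SinglesDistinct col (Perm.lift₀ π) (suc s)
    distinct′ zero zero _ _ _ = refl
    distinct′ zero (suc b) _ (s≤s b<s) e = ⊥-elim (unmatched (b , b<s , sym e))
    distinct′ (suc a) zero (s≤s a<s) _ e = ⊥-elim (unmatched (a , a<s , e))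
    distinct′ (suc a) (suc b) (s≤s a<s) (s≤s b<s) e = cong suc (distinct a b a<s b<s e)
    paired′ : PairsEqual col (Perm.lift₀ π) (suc s) p
    paired′ (suc a) (suc b) (s≤s s≤a) (s≤s a<s+p) b≡a+p = paired a b s≤a a<s+p (suc-injective b≡a+p)

  -- the matched single is first swapped to the end of the singles block; it then
  -- opens the pairs block and the new position opens the second half
  extend-matched : ∀ {k} (col : Fin (suc k) → X) (R : Arrangement (col ∘ suc)) →
    Matches col R → Arrangement col
  extend-matched col (arrangement zero _ _ _ _ _) (_ , () , _)
  extend-matched {k} col (arrangement (suc s) p len π distinct paired) (a₀ , a₀<s , a₀≈0) =
    arrangement s (suc p) len′ π′ distinct′ paired′
    where
    len′ : suc k ≡ s + (suc p + suc p)
    len′ = trans (cong suc len) (sym (trans (+-suc s (p + suc p)) (cong suc (trans (cong (s +_) (+-suc p p)) (+-suc s (p + p))))))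
    s<k : s < k
    s<k = subst (s <_) (sym len) (s≤s (m≤m+n s (p + p)))
    last : Fin k
    last = fromℕ< s<k
    τ = PC.transpose a₀ last
    q<k : suc s + p < suc k
    q<k = s≤s (subst (suc s + p ≤_) (sym len) (+-monoʳ-≤ (suc s) (m≤m+n p p)))
    q : Fin (suc k)
    q = fromℕ< q<k
    toℕ-q : toℕ q ≡ suc s + p
    toℕ-q = toℕ-fromℕ< q<k
    π′ = Perm.insert q zero (Perm.transpose a₀ last ∘ₚ π)
    π′-q : π′ ⟨$⟩ʳ q ≡ zero
    π′-q = insert-at q zero _
    π′-punchIn : ∀ y → π′ ⟨$⟩ʳ punchIn q y ≡ suc (π ⟨$⟩ʳ τ y)
    π′-punchIn y = Perm.insert-punchIn q zero _ y
    last<s : toℕ last < suc s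
    last<s = subst (_< suc s) (sym (toℕ-fromℕ< s<k)) (n<1+n s)
    τ-singles : ∀ y → toℕ y < s → toℕ (τ y) < suc s
    τ-singles y y<s = transpose-preserves-< a₀ last y a₀<s last<s (<-trans y<s (n<1+n s))
    τ-pairs : ∀ y → suc s ≤ toℕ y → τ y ≡ y
    τ-pairs y s<y = transpose-fixes-≥ a₀ last y a₀<s last<s s<y
    τ-injective : ∀ x y → τ x ≡ τ y → x ≡ y
    τ-injective x y e = trans (sym (PC.transpose-inverse last a₀))
                              (trans (cong (PC.transpose last a₀) e) (PC.transpose-inverse last a₀))
    below-q : ∀ a → toℕ a < s + suc p → toℕ a < toℕ q
    below-q a a<q = subst (toℕ a <_) (sym (trans toℕ-q (sym (+-suc s p)))) a<q
    distinct′ : SinglesDistinct col π′ s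
    distinct′ a b a<s b<s e
      with punchIn-below q a (below-q a (<-≤-trans a<s (m≤m+n s (suc p))))
         | punchIn-below q b (below-q b (<-≤-trans b<s (m≤m+n s (suc p))))
    ... | y , refl , toℕ-y | z , refl , toℕ-z =
      cong (toℕ ∘ punchIn q) (τ-injective y z (toℕ-injective
        (distinct _ _ (τ-singles y (subst (_< s) (sym toℕ-y) a<s)) (τ-singles z (subst (_< s) (sym toℕ-z) b<s))
          (trans (cong col (sym (π′-punchIn y))) (trans e (cong col (π′-punchIn z)))))))
    paired′ : PairsEqual col π′ s (suc p)
    paired′ a b s≤a a<q b≡a+p with m≤n⇒m<n∨m≡n s≤a | punchIn-below q a (below-q a a<q)
    ... | inj₂ s≡a | y , refl , toℕ-y = begin
      col (π′ ⟨$⟩ʳ punchIn q y)  ≡⟨ cong col (π′-punchIn y) ⟩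
      col (suc (π ⟨$⟩ʳ τ y))     ≡⟨ cong (λ y → col (suc (π ⟨$⟩ʳ τ y))) y≡last ⟩
      col (suc (π ⟨$⟩ʳ τ last))  ≡⟨ cong (λ y → col (suc (π ⟨$⟩ʳ y))) (transpose-matchʳ a₀ last) ⟩
      col (suc (π ⟨$⟩ʳ a₀))      ≡⟨ a₀≈0 ⟩
      col zero                   ≡⟨ cong col (trans (sym π′-q) (cong (π′ ⟨$⟩ʳ_) (sym b≡q))) ⟩
      col (π′ ⟨$⟩ʳ b)            ∎
      where
      y≡last : y ≡ last
      y≡last = toℕ-injective (trans toℕ-y (trans (sym s≡a) (sym (toℕ-fromℕ< s<k))))
      b≡q : b ≡ q
      b≡q = toℕ-injective (trans b≡a+p (trans (cong (_+ suc p) (sym s≡a)) (trans (+-suc s p) (sym toℕ-q))))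
    ... | inj₁ s<a | y , refl , toℕ-y with punchIn-above q b q<b
      where
      q<b : toℕ q < toℕ b
      q<b = subst (toℕ q <_) (sym b≡a+p) (subst (_< toℕ (punchIn q y) + suc p) (sym toℕ-q) (+-mono-≤-< s<a (n<1+n p)))
    ... | z , refl , toℕ-z = begin
      col (π′ ⟨$⟩ʳ punchIn q y)  ≡⟨ cong col (π′-punchIn y) ⟩
      col (suc (π ⟨$⟩ʳ τ y))     ≡⟨ cong (λ y → col (suc (π ⟨$⟩ʳ y))) (τ-pairs y s<y) ⟩
      col (suc (π ⟨$⟩ʳ y))       ≡⟨ paired y z s<y y<s+p z≡y+p ⟩
      col (suc (π ⟨$⟩ʳ z))       ≡⟨ cong (λ z → col (suc (π ⟨$⟩ʳ z))) (τ-pairs z s<z) ⟨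
      col (suc (π ⟨$⟩ʳ τ z))     ≡⟨ cong col (π′-punchIn z) ⟨
      col (π′ ⟨$⟩ʳ punchIn q z)  ∎
      where
      s<y : suc s ≤ toℕ y
      s<y = subst (suc s ≤_) (sym toℕ-y) s<a
      y<s+p : toℕ y < suc s + p
      y<s+p = subst (_< suc s + p) (sym toℕ-y) (subst (toℕ (punchIn q y) <_) (+-suc s p) a<q)
      z≡y+p : toℕ z ≡ toℕ y + p
      z≡y+p = suc-injective (trans toℕ-z (trans b≡a+p
                (trans (+-suc (toℕ (punchIn q y)) p) (cong (λ n → suc (n + p)) (sym toℕ-y)))))
      s<z : suc s ≤ toℕ z
      s<z = subst (suc s ≤_) (sym z≡y+p) (≤-trans s<y (m≤m+n (toℕ y) p))

  arrange : DecidableEquality X → ∀ {k} (col : Fin k → X) → Arrangement col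
  arrange _≟ₓ_ {zero} col = arrangement 0 0 refl Perm.id (λ ()) (λ ())
  arrange _≟ₓ_ {suc k} col with arrange _≟ₓ_ (col ∘ suc)
  ... | R with any? (λ a → (toℕ a <? Arrangement.singles R) ×-dec (col (suc (Arrangement.π R ⟨$⟩ʳ a)) ≟ₓ col zero))
  ...   | no unmatched = extend-unmatched col R unmatched
  ...   | yes match = extend-matched col R match

  module _ {s p} (col : Fin (s + (p + p)) → X) (π : Permutation′ (s + (p + p))) where

    single-injective : SinglesDistinct col π s →
      ∀ a b → col (π ⟨$⟩ʳ (a ↑ˡ (p + p))) ≡ col (π ⟨$⟩ʳ (b ↑ˡ (p + p))) → a ≡ b
    single-injective distinct a b e = toℕ-injective (begin
      toℕ a                ≡⟨ toℕ-↑ˡ a (p + p) ⟨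
      toℕ (a ↑ˡ (p + p))   ≡⟨ distinct _ _ (below a) (below b) e ⟩
      toℕ (b ↑ˡ (p + p))   ≡⟨ toℕ-↑ˡ b (p + p) ⟩
      toℕ b                ∎)
      where
      below : ∀ a → toℕ (a ↑ˡ (p + p)) < s
      below a = subst (_< s) (sym (toℕ-↑ˡ a (p + p))) (toℕ<n a)

    pair-equal : PairsEqual col π s p →
      ∀ x → col (π ⟨$⟩ʳ (s ↑ʳ (x ↑ˡ p))) ≡ col (π ⟨$⟩ʳ (s ↑ʳ (p ↑ʳ x)))
    pair-equal paired x = paired _ _ (subst (s ≤_) (sym first) (m≤m+n s (toℕ x)))
      (subst (_< s + p) (sym first) (+-monoʳ-< s (toℕ<n x))) second
      where
      first : toℕ (s ↑ʳ (x ↑ˡ p)) ≡ s + toℕ x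
      first = trans (toℕ-↑ʳ s (x ↑ˡ p)) (cong (s +_) (toℕ-↑ˡ x p))
      second : toℕ (s ↑ʳ (p ↑ʳ x)) ≡ toℕ (s ↑ʳ (x ↑ˡ p)) + p
      second = begin
        toℕ (s ↑ʳ (p ↑ʳ x)) ≡⟨ toℕ-↑ʳ s (p ↑ʳ x) ⟩
        s + toℕ (p ↑ʳ x)    ≡⟨ cong (s +_) (trans (toℕ-↑ʳ p x) (+-comm p (toℕ x))) ⟩
        s + (toℕ x + p)     ≡⟨ +-assoc s (toℕ x) p ⟨
        s + toℕ x + p       ≡⟨ cong (_+ p) first ⟨
        toℕ (s ↑ʳ (x ↑ˡ p)) + p ∎

-- The columns of a generator matrix

column : ∀ {n} → (Fin 3 → Word n) → Fin n → B³
column g j = g zero j , g (suc zero) j , g (suc (suc zero)) j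

column-! : ∀ {n} (g : Fin 3 → Word n) j k → column g j ! k ≡ g k j
column-! g j zero = refl
column-! g j (suc zero) = refl
column-! g j (suc (suc zero)) = refl

entry-gram-column : ∀ {n} (g : Fin 3 → Word n) i k → entry (gram (column g)) i k ≡ dot (g i) (g k)
entry-gram-column g i k = trans (entry-gram (column g) i k) (xorSum-cong λ j → cong₂ _∧_ (column-! g j i) (column-! g j k))

zero-column : ∀ {n} (g : Fin 3 → Word n) j → nonzero (column g j) ≡ false → ∀ k → g k j ≡ false
zero-column g j c≡0 zero with g zero j | c≡0
... | false | _ = refl
zero-column g j c≡0 (suc zero) with g zero j | g (suc zero) j | c≡0
... | false | false | _ = refl
zero-column g j c≡0 (suc (suc zero)) with g zero j | g (suc zero) j | g (suc (suc zero)) j | c≡0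
... | false | false | false | _ = refl

unitWord : ∀ {n} → Fin n → Word n
unitWord j i = does (i ≟ j)

dot-unitWord : ∀ {n} (j : Fin n) (v : Word n) → dot (unitWord j) v ≡ v j
dot-unitWord {suc n} zero v = trans (cong (v zero xor_) (xorSum-false n)) (xor-identityʳ (v zero))
dot-unitWord {suc n} (suc j) v = dot-unitWord j (v ∘ suc)

weight-unitWord : ∀ {n} (j : Fin n) → weight (unitWord j) ≡ 1
weight-unitWord {suc n} zero = cong suc (weight-false n)
  where
  weight-false : ∀ n → weight {n} (λ _ → false) ≡ 0
  weight-false zero = refl
  weight-false (suc n) = weight-false n
weight-unitWord {suc n} (suc j) = weight-unitWord j

module _ {n} {C : Code n} (g : Fin 3 → Word n) (C⇔span : ∀ w → C w ⇔ InSpan g w) where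

  orthogonal⇒dual : ∀ w → (∀ k → dot w (g k) ≡ false) → Dual C w
  orthogonal⇒dual w w⊥g v v∈C with Equivalence.to (C⇔span v) v∈C
  ... | d , v≡dg = begin
    dot w v                           ≡⟨ xorSum-cong (λ j → cong (w j ∧_) (v≡dg j)) ⟩
    dot w (lincomb d g)               ≡⟨ dot-lincombʳ w d g ⟩
    xorSum (λ k → d k ∧ dot w (g k))  ≡⟨ xorSum-cong (λ k → trans (cong (d k ∧_) (w⊥g k)) (∧-zeroʳ (d k))) ⟩
    xorSum {3} (λ _ → false)          ≡⟨ xorSum-false 3 ⟩
    false                             ∎

  -- a kernel vector c of the Gram matrix gives the nonzero codeword Σᵢ cᵢ gᵢ, which lies in C⊥
  invertible-gram : LinIndep g → IsLCD C → det (gram (column g)) ≡ true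
  invertible-gram independent lcd with det (gram (column g)) in singular
  ... | true = refl
  ... | false = ⊥-elim (kernel-contradiction (singular⇒kernel (gram (column g)) singular))
    where
    G = gram (column g)
    kernel-contradiction : (Σ B³ λ c → nonzero c ≡ true × G · c ≡ 0³) → ⊥
    kernel-contradiction (c , c≢0 , Gc≡0) with nonzero-! c c≢0
    ... | k , cₖ≡true = case trans (sym cₖ≡true) (independent (c !_) w≡0 k) of λ ()
      where
      w = lincomb (c !_) g
      w⊥g : ∀ k → dot w (g k) ≡ false
      w⊥g k = begin
        dot w (g k)                                  ≡⟨ dot-lincombˡ (c !_) g (g k) ⟩
        xorSum (λ i → c ! i ∧ dot (g i) (g k))
          ≡⟨ xorSum-cong (λ i → trans (∧-comm (c ! i) _)
               (cong (_∧ c ! i) (trans (dot-comm (g i) (g k)) (sym (entry-gram-column g k i))))) ⟩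
        xorSum (λ i → entry G k i ∧ c ! i)           ≡⟨ !-· G c k ⟨
        (G · c) ! k                                  ≡⟨ cong (_! k) Gc≡0 ⟩
        0³ ! k                                       ≡⟨ !-0³ k ⟩
        false                                        ∎
      w≡0 : IsZero w
      w≡0 = lcd w (Equivalence.from (C⇔span w) ((c !_) , λ _ → refl)) (orthogonal⇒dual w w⊥g)

  nonzero-columns : MinDistAtLeast (Dual C) 2 → ∀ j → nonzero (column g j) ≡ true
  nonzero-columns distance j with nonzero (column g j) in zero-col
  ... | true = refl
  ... | false = ⊥-elim (1+n≰n (subst (2 ≤_) (weight-unitWord j) (distance (unitWord j) eⱼ∈C⊥ eⱼ≢0)))
    where
    eⱼ∈C⊥ : Dual C (unitWord j)
    eⱼ∈C⊥ = orthogonal⇒dual (unitWord j) λ k → trans (dot-unitWord j (g k)) (zero-column g j zero-col k)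
    eⱼ≢0 : ¬ IsZero (unitWord j)
    eⱼ≢0 eⱼ≡0 = case trans (sym (dec-true (j ≟ j) refl)) (eⱼ≡0 j) of λ ()

gram-paired : ∀ s p (h : Fin (s + (p + p)) → B³) (π : Permutation′ (s + (p + p))) →
  (∀ x → h (π ⟨$⟩ʳ (s ↑ʳ (x ↑ˡ p))) ≡ h (π ⟨$⟩ʳ (s ↑ʳ (p ↑ʳ x)))) →
  gram h ≡ gram (λ (a : Fin s) → h (π ⟨$⟩ʳ (a ↑ˡ (p + p))))
gram-paired s p h π paired = Mat³-ext {gram h} {gram single} λ i k → begin
  entry (gram h) i k                                   ≡⟨ entry-gram h i k ⟩
  xorSum (f i k)                                       ≡⟨ xorSum-permute (f i k) π ⟩
  xorSum (f′ i k)                                      ≡⟨ xorSum-++ s (f′ i k) ⟩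
  xorSum (f′ i k ∘ singles) xor xorSum (f′ i k ∘ (s ↑ʳ_))
    ≡⟨ cong (xorSum (f′ i k ∘ singles) xor_) (xorSum-paired p _ (λ x → cong (λ v → v ! i ∧ v ! k) (paired x))) ⟩
  xorSum (f′ i k ∘ singles) xor false                  ≡⟨ xor-identityʳ _ ⟩
  xorSum (f′ i k ∘ singles)                            ≡⟨ entry-gram single i k ⟨
  entry (gram single) i k                              ∎
  where
  singles : Fin s → Fin (s + (p + p))
  singles a = a ↑ˡ (p + p)
  single : Fin s → B³
  single = h ∘ (π ⟨$⟩ʳ_) ∘ singles
  f f′ : Fin 3 → Fin 3 → Fin (s + (p + p)) → Bool
  f i k j = h j ! i ∧ h j ! k
  f′ i k = f i k ∘ (π ⟨$⟩ʳ_)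

singles-invertible-gram : ∀ {k} (h : Fin k → B³) → (∀ j → nonzero (h j) ≡ true) →
  det (gram h) ≡ true → (R : Arrangement h) → Arrangement.singles R ≡ 3 ⊎ Arrangement.singles R ≡ 4
singles-invertible-gram h nonzero-h invertible (arrangement s p refl π distinct paired) =
  size-invertible-gram (λ (a : Fin s) → h (π ⟨$⟩ʳ (a ↑ˡ (p + p))))
    (single-injective {s = s} {p} h π distinct) (nonzero-h ∘ _)
    (subst (λ M → det M ≡ true) (gram-paired s p h π (pair-equal {s = s} {p} h π paired)) invertible)

double-injective : ∀ m n → m + m ≡ n + n → m ≡ n
double-injective m n e = trans (n≡⌊n+n/2⌋ m) (trans (cong ⌊_/2⌋ e) (sym (n≡⌊n+n/2⌋ n)))

even≢odd : ∀ m n → m + m ≢ suc (n + n)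
even≢odd zero n ()
even≢odd (suc m) zero e = case trans (sym (cong suc (+-suc m m))) e of λ ()
even≢odd (suc m) (suc n) e =
  even≢odd m n (suc-injective (suc-injective
    (trans (sym (cong suc (+-suc m m))) (trans e (cong suc (cong suc (+-suc n n)))))))

three-singles : ∀ {s p m} → s ≡ 3 ⊎ s ≡ 4 → s + (p + p) ≡ 3 + (m + m) → s ≡ 3 × p ≡ m
three-singles {p = p} {m} (inj₁ refl) e = refl , double-injective p m (suc-injective (suc-injective (suc-injective e)))
three-singles {p = p} {m} (inj₂ refl) e = ⊥-elim (even≢odd m p (sym (suc-injective (suc-injective (suc-injective e)))))

module NormalForm {m} (g : Fin 3 → Word (3 + (m + m))) (π : Permutation′ (3 + (m + m)))
  (paired : ∀ x → column g (π ⟨$⟩ʳ (3 ↑ʳ (x ↑ˡ m))) ≡ column g (π ⟨$⟩ʳ (3 ↑ʳ (m ↑ʳ x))))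
  (invertible : det (gram (column g)) ≡ true) where

  basis : Fin 3 → B³
  basis r = column g (π ⟨$⟩ʳ (r ↑ˡ (m + m)))

  basis-invertible : det (columns basis) ≡ true
  basis-invertible = det-gram basis (subst (λ M → det M ≡ true) (gram-paired 3 m (column g) π paired) invertible)

  coordinates : Fin (3 + (m + m)) → B³
  coordinates j = adj (columns basis) · column g (π ⟨$⟩ʳ j)

  Y : Fin 3 → Subset m
  Y r x = coordinates (3 ↑ʳ (x ↑ˡ m)) ! r

  zvec-coordinates : ∀ r j → zvec Y r j ≡ coordinates j ! r
  zvec-coordinates r j with splitAt 3 j in split₁
  ... | inj₁ k = begin
    ⌊ k ≟ r ⌋                     ≡⟨ !-unit³ k r ⟨
    unit³ k ! r                   ≡⟨ cong (_! r) (adj-columns basis basis-invertible k) ⟨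
    coordinates (k ↑ˡ (m + m)) ! r ≡⟨ cong (λ j → coordinates j ! r) (splitAt⁻¹-↑ˡ split₁) ⟩
    coordinates j ! r             ∎
  ... | inj₂ j′ with splitAt m j′ in split₂
  ...   | inj₁ x =
    cong (λ j → coordinates j ! r) (trans (cong (3 ↑ʳ_) (splitAt⁻¹-↑ˡ split₂)) (splitAt⁻¹-↑ʳ split₁))
  ...   | inj₂ x = begin
    coordinates (3 ↑ʳ (x ↑ˡ m)) ! r ≡⟨ cong (λ v → (adj (columns basis) · v) ! r) (paired x) ⟩
    coordinates (3 ↑ʳ (m ↑ʳ x)) ! r
      ≡⟨ cong (λ j → coordinates j ! r) (trans (cong (3 ↑ʳ_) (splitAt⁻¹-↑ʳ split₂)) (splitAt⁻¹-↑ʳ split₁)) ⟩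
    coordinates j ! r               ∎

  columns-in-span : ∀ k → InSpan (zvec Y) (g k ∘ (π ⟨$⟩ʳ_))
  columns-in-span k = (λ r → basis r ! k) , λ j → begin
    g k (π ⟨$⟩ʳ j)                                    ≡⟨ column-! g (π ⟨$⟩ʳ j) k ⟨
    column g (π ⟨$⟩ʳ j) ! k                           ≡⟨ cong (_! k) (adj-inverseʳ (columns basis) basis-invertible _) ⟨
    (columns basis · coordinates j) ! k               ≡⟨ !-· (columns basis) (coordinates j) k ⟩
    xorSum (λ r → entry (columns basis) k r ∧ coordinates j ! r)
      ≡⟨ xorSum-cong (λ r → cong₂ _∧_ (entry-columns basis k r) (sym (zvec-coordinates r j))) ⟩
    xorSum (λ r → basis r ! k ∧ zvec Y r j)           ∎

  zvec-in-span : ∀ r → InSpan (λ k → g k ∘ (π ⟨$⟩ʳ_)) (zvec Y r)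
  zvec-in-span r = (λ k → entry (adj (columns basis)) r k) , λ j → begin
    zvec Y r j                                                        ≡⟨ zvec-coordinates r j ⟩
    coordinates j ! r                                                 ≡⟨ !-· (adj (columns basis)) _ r ⟩
    xorSum (λ k → entry (adj (columns basis)) r k ∧ column g (π ⟨$⟩ʳ j) ! k)
      ≡⟨ xorSum-cong (λ k → cong (entry (adj (columns basis)) r k ∧_) (column-! g (π ⟨$⟩ʳ j) k)) ⟩
    xorSum (λ k → entry (adj (columns basis)) r k ∧ g k (π ⟨$⟩ʳ j))   ∎

  equivalent : ∀ {C} → (∀ w → C w ⇔ InSpan g w) → Equivalent C (CY Y)
  equivalent C⇔span = π , λ w → mk⇔
    (InSpan-trans {z = zvec Y} columns-in-span (w ∘ (π ⟨$⟩ʳ_))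
      ∘ InSpan-permute g π w ∘ Equivalence.to (C⇔span w))
    (Equivalence.from (C⇔span w) ∘ InSpan-unpermute g π w
      ∘ InSpan-trans {z = λ k → g k ∘ (π ⟨$⟩ʳ_)} zvec-in-span (w ∘ (π ⟨$⟩ʳ_)))

  cover : (∀ j → nonzero (column g j) ≡ true) → Is3Cover Y
  cover nonzero-col x = adj-nonzero (columns basis) basis-invertible _ (nonzero-col _)

proposition3p5 : (m : ℕ) → 1 ≤ m → (C : Code (3 + (m + m))) →
    IsLinearCode (3 + (m + m)) 3 C → IsLCD C → MinDistAtLeast (Dual C) 2 →
    Σ (Fin 3 → Subset m) (λ Y → Is3Cover Y × Equivalent C (CY Y))
proposition3p5 m _ C (g , independent , C⇔span) lcd distance = normalise (arrange _≟³_ (column g))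
  where
  invertible : det (gram (column g)) ≡ true
  invertible = invertible-gram g C⇔span independent lcd
  nonzero-col : ∀ j → nonzero (column g j) ≡ true
  nonzero-col = nonzero-columns g C⇔span distance
  normalise : Arrangement (column g) → Σ (Fin 3 → Subset m) (λ Y → Is3Cover Y × Equivalent C (CY Y))
  normalise R@(arrangement s p length π _ paired)
    with three-singles {p = p} {m} (singles-invertible-gram (column g) nonzero-col invertible R) (sym length)
  ... | refl , refl = Y , cover nonzero-col , equivalent C⇔span
    where open NormalForm g π (pair-equal (column g) π paired) invertible
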